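{- For every $\alpha\in Fm''$: if $\vdash_{\mathbb T}\alpha$, then $\models_{\cal TML}\alpha$.
   Context: $M_4=\{\mathbf 0,\mathbf n,\mathbf b,\mathbf 1\}$ with $\neg\mathbf 0=\mathbf 1$, $\neg\mathbf 1=\mathbf 0$, $\neg\mathbf n=\mathbf n$, $\neg\mathbf b=\mathbf b$ and $\succ$: $\mathbf 0\succ y=\mathbf 1$; $\mathbf n\succ\mathbf 0=\mathbf n$, $\mathbf n\succ\mathbf n=\mathbf 1$, $\mathbf n\succ\mathbf b=\mathbf b$, $\mathbf n\succ\mathbf 1=\mathbf 1$; $\mathbf b\succ\mathbf 0=\mathbf b$, $\mathbf b\succ\mathbf n=\mathbf n$, $\mathbf b\succ\mathbf b=\mathbf 1$, $\mathbf b\succ\mathbf 1=\mathbf 1$; $\mathbf 1\succ y=y$. Formulas of $Fm''$ are built from propositional variables with $\neg$, $\succ$; a valuation is a homomorphism $h:Fm''\to M_4$; $\models_{\cal TML}\alpha$ means $h(\alpha)=\mathbf 1$ for every valuation $h$. Signed formulas are $T(\alpha)$, $F(\alpha)$. Rules of $\mathbb T$ (premise $\Rightarrow$ conclusion sets separated by $|$): $T(\alpha\succ\beta)\Rightarrow \{T(\beta)\}\,|\,\{T(\neg\alpha),F(\beta),T(\neg\beta)\}\,|\,\{F(\alpha),F(\beta),F(\neg\beta)\}$; $F(\alpha\succ\beta)\Rightarrow\{T(\alpha),F(\beta),F(\neg\beta)\}\,|\,\{F(\neg\alpha),F(\beta),T(\neg\beta)\}$; $T(\neg(\alpha\succ\beta))\Rightarrow\{T(\alpha),F(\beta),T(\neg\beta)\}\,|\,\{F(\neg\alpha),T(\beta),T(\neg\beta)\}$;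 $F(\neg(\alpha\succ\beta))\Rightarrow\{F(\neg\beta)\}\,|\,\{T(\neg\alpha),T(\beta),T(\neg\beta)\}\,|\,\{F(\alpha),F(\beta),T(\neg\beta)\}$; $T(\neg\neg\alpha)\Rightarrow\{T(\alpha)\}$; $F(\neg\neg\alpha)\Rightarrow\{F(\alpha)\}$. A tableau for $\eta$ is a finite tree with root $\eta$ built by repeatedly choosing a non-closed branch and a signed formula on it that is a rule premise, and extending the branch by one sub-branch per conclusion set. A branch is closed if it contains $T(\gamma)$ and $F(\gamma)$ for some $\gamma$; a tableau is closed if all branches are closed. $\vdash_{\mathbb T}\alpha$ means there exists a closed tableau for $F(\alpha)$. -}

module Defs where

open import Data.Nat using (ℕ)
open import Data.List using (List; []; _∷_; _++_)
open import Data.List.Membership.Propositional using (_∈_)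
open import Data.List.Relation.Unary.All using (All)
open import Data.Product using (∃; _×_; _,_)
open import Relation.Binary.PropositionalEquality using (_≡_)
open import Relation.Nullary using (¬_)

data M4 : Set where
  𝟎 𝐧 𝐛 𝟏 : M4

¬ₘ : M4 → M4
¬ₘ 𝟎 = 𝟏
¬ₘ 𝟏 = 𝟎
¬ₘ 𝐧 = 𝐧
¬ₘ 𝐛 = 𝐛

_≻ₘ_ : M4 → M4 → M4
𝟎 ≻ₘ y = 𝟏
𝐧 ≻ₘ 𝟎 = 𝐧
𝐧 ≻ₘ 𝐧 = 𝟏
𝐧 ≻ₘ 𝐛 = 𝐛
𝐧 ≻ₘ 𝟏 = 𝟏
𝐛 ≻ₘ 𝟎 = 𝐛
𝐛 ≻ₘ 𝐧 = 𝐧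
𝐛 ≻ₘ 𝐛 = 𝟏
𝐛 ≻ₘ 𝟏 = 𝟏
𝟏 ≻ₘ y = y

-- Formulas of Fm'' over propositional variables indexed by ℕ
data Fm : Set where
  var : ℕ → Fm
  ~_  : Fm → Fm
  _≻_ : Fm → Fm → Fm

infixr 5 _≻_
infix 6 ~_

-- Valuations: homomorphisms Fm → M4, determined by values on variables
⟦_⟧ : Fm → (ℕ → M4) → M4
⟦ var p ⟧ v = v p
⟦ ~ a ⟧ v = ¬ₘ (⟦ a ⟧ v)
⟦ a ≻ b ⟧ v = ⟦ a ⟧ v ≻ₘ ⟦ b ⟧ v

⊨TML : Fm → Set
⊨TML a = (v : ℕ → M4) → ⟦ a ⟧ v ≡ 𝟏

data SFm : Set where
  T F : Fm → SFm

-- Rules of 𝕋: Rule premise conclusions (each conclusion set is a list)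
data Rule : SFm → List (List SFm) → Set where
  T≻  : ∀ a b → Rule (T (a ≻ b))
          ((T b ∷ []) ∷ (T (~ a) ∷ F b ∷ T (~ b) ∷ []) ∷ (F a ∷ F b ∷ F (~ b) ∷ []) ∷ [])
  F≻  : ∀ a b → Rule (F (a ≻ b))
          ((T a ∷ F b ∷ F (~ b) ∷ []) ∷ (F (~ a) ∷ F b ∷ T (~ b) ∷ []) ∷ [])
  T~≻ : ∀ a b → Rule (T (~ (a ≻ b)))
          ((T a ∷ F b ∷ T (~ b) ∷ []) ∷ (F (~ a) ∷ T b ∷ T (~ b) ∷ []) ∷ [])
  F~≻ : ∀ a b → Rule (F (~ (a ≻ b)))
          ((F (~ b) ∷ []) ∷ (T (~ a) ∷ T b ∷ T (~ b) ∷ []) ∷ (F a ∷ F b ∷ T (~ b) ∷ []) ∷ [])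
  T~~ : ∀ a → Rule (T (~ ~ a)) ((T a ∷ []) ∷ [])
  F~~ : ∀ a → Rule (F (~ ~ a)) ((F a ∷ []) ∷ [])

Closed : List SFm → Set
Closed br = ∃ λ g → T g ∈ br × F g ∈ br

-- ClosedTableauFrom br: a finite tableau tree extending the branch br
-- all of whose branches are closed.
data ClosedTableauFrom (br : List SFm) : Set where
  leaf   : Closed br → ClosedTableauFrom br
  expand : (η : SFm) (cs : List (List SFm)) →
           ¬ Closed br → η ∈ br → Rule η cs →
           All (λ c → ClosedTableauFrom (c ++ br)) cs →
           ClosedTableauFrom br

⊢𝕋 : Fm → Set
⊢𝕋 a = ClosedTableauFrom (F a ∷ [])

-- A tableau rule read with "T α" as "α takes a designated value, 𝐛 or 𝟏" is
-- sound: whenever its premise holds under a valuation, so does one of its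
-- conclusion sets. A closed tableau for F(α) therefore shows that α is
-- designated under every valuation. Swapping 𝐧 and 𝐛 is an automorphism of M4,
-- so α is also never valued 𝐛 (apply the first fact to the swapped valuation);
-- the only designated value left is 𝟏.
module Submission where

open import Defs
open import Data.Nat using (ℕ; zero; suc)
open import Data.Bool using (Bool; true; false; _∨_; not) renaming (T to IsTrue)
open import Data.Bool.ListAction using (all; any)
open import Data.Bool.Properties using (T-not-≡)
open import Data.List using (List; []; _∷_; _++_)
open import Data.List.Membership.Propositional using (_∈_)
open import Data.List.Relation.Unary.All using (All; []; _∷_; lookup)
open import Data.List.Relation.Unary.All.Properties using (++⁺; all⁺)
open import Data.List.Relation.Unary.Any as Any using (Any; here; there)
open import Data.List.Relation.Unary.Any.Properties using (any⁻)
open import Data.Empty using (⊥-elim)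
open import Data.Product using (_,_)
open import Function using (_∘_; Equivalence)
open import Relation.Binary.PropositionalEquality using (_≡_; refl; sym; trans; cong; cong₂; subst)
open import Relation.Nullary using (¬_)

designated : M4 → Bool
designated 𝟏 = true
designated 𝐛 = true
designated 𝟎 = false
designated 𝐧 = false

holds : (ℕ → M4) → SFm → Bool
holds v (T a) = designated (⟦ a ⟧ v)
holds v (F a) = not (designated (⟦ a ⟧ v))

Holds : (ℕ → M4) → SFm → Set
Holds v = IsTrue ∘ holds v

modus-ponens : ∀ {b c} → IsTrue (not b ∨ c) → IsTrue b → IsTrue c
modus-ponens {true} h _ = h

not-both : ∀ b → IsTrue b → ¬ IsTrue (not b)
not-both true _ ()

closed-unsatisfiable : ∀ v {br} → Closed br → ¬ All (Holds v) br
closed-unsatisfiable v (g , Tg∈br , Fg∈br) sat =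
  not-both (designated (⟦ g ⟧ v)) (lookup sat Tg∈br) (lookup sat Fg∈br)

respects : (ℕ → M4) → SFm → List (List SFm) → Bool
respects v η cs = not (holds v η) ∨ any (all (holds v)) cs

valuation₂ : M4 → M4 → ℕ → M4
valuation₂ x y zero    = x
valuation₂ x y (suc _) = y

elements : List M4
elements = 𝟎 ∷ 𝐧 ∷ 𝐛 ∷ 𝟏 ∷ []

∈-elements : ∀ x → x ∈ elements
∈-elements 𝟎 = here refl
∈-elements 𝐧 = there (here refl)
∈-elements 𝐛 = there (there (here refl))
∈-elements 𝟏 = there (there (there (here refl)))

every : (M4 → Bool) → Bool
every p = all p elements

every-sound : (p : M4 → Bool) → IsTrue (every p) → ∀ x → IsTrue (p x)
every-sound p h x = lookup (all⁺ p elements h) (∈-elements x)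

every₂-sound : (p : M4 → M4 → Bool) → IsTrue (every λ x → every (p x)) → ∀ x y → IsTrue (p x y)
every₂-sound p h x = every-sound (p x) (every-sound (λ x → every (p x)) h x)

-- Every premise and conclusion of an instance of a rule at formulas a and b is
-- built from a and b, so its value depends only on ⟦ a ⟧ v and ⟦ b ⟧ v, and
-- equals, definitionally, the value of the same rule at the variables 0 and 1
-- under valuation₂ (⟦ a ⟧ v) (⟦ b ⟧ v). It thus suffices to check each rule on
-- those two variables for all 16 pairs of values; that check is the argument _
-- of every₂-sound below, closed by evaluation.
at-values : ∀ {η cs} → Rule η cs → M4 → M4 → Bool
at-values {η} {cs} _ x y = respects (valuation₂ x y) η cs

rule-respected : ∀ v {η cs} (r : Rule η cs) → IsTrue (respects v η cs)
rule-respected v (T≻ a b)  = every₂-sound (at-values (T≻ (var 0) (var 1))) _ (⟦ a ⟧ v) (⟦ b ⟧ v)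
rule-respected v (F≻ a b)  = every₂-sound (at-values (F≻ (var 0) (var 1))) _ (⟦ a ⟧ v) (⟦ b ⟧ v)
rule-respected v (T~≻ a b) = every₂-sound (at-values (T~≻ (var 0) (var 1))) _ (⟦ a ⟧ v) (⟦ b ⟧ v)
rule-respected v (F~≻ a b) = every₂-sound (at-values (F~≻ (var 0) (var 1))) _ (⟦ a ⟧ v) (⟦ b ⟧ v)
rule-respected v (T~~ a)   = every₂-sound (at-values (T~~ (var 0))) _ (⟦ a ⟧ v) (⟦ a ⟧ v)
rule-respected v (F~~ a)   = every₂-sound (at-values (F~~ (var 0))) _ (⟦ a ⟧ v) (⟦ a ⟧ v)

rule-sound : ∀ v {η cs} → Rule η cs → Holds v η → Any (All (Holds v)) cs
rule-sound v {cs = cs} r η-holds =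
  Any.map (all⁺ (holds v) _) (any⁻ (all (holds v)) cs (modus-ponens (rule-respected v r) η-holds))

mutual
  tableau-sound : ∀ v {br} → ClosedTableauFrom br → ¬ All (Holds v) br
  tableau-sound v (leaf closed) = closed-unsatisfiable v closed
  tableau-sound v (expand η cs _ η∈br r subtableaux) sat =
    some-subtableau-sound v subtableaux (rule-sound v r (lookup sat η∈br)) sat

  some-subtableau-sound : ∀ v {br cs} → All (λ c → ClosedTableauFrom (c ++ br)) cs →
                          Any (All (Holds v)) cs → ¬ All (Holds v) br
  some-subtableau-sound v (t ∷ _)  (here c-sat)  br-sat = tableau-sound v t (++⁺ c-sat br-sat)
  some-subtableau-sound v (_ ∷ ts) (there c-sat) br-sat = some-subtableau-sound v ts c-sat br-sat

provable⇒designated : ∀ {α} → ⊢𝕋 α → ∀ v → IsTrue (designated (⟦ α ⟧ v))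
provable⇒designated {α} ⊢α v with designated (⟦ α ⟧ v) in eq
... | true  = _
... | false = ⊥-elim (tableau-sound v ⊢α (Equivalence.from T-not-≡ eq ∷ []))

swap : M4 → M4
swap 𝟎 = 𝟎
swap 𝐧 = 𝐛
swap 𝐛 = 𝐧
swap 𝟏 = 𝟏

swap-¬ₘ : ∀ x → swap (¬ₘ x) ≡ ¬ₘ (swap x)
swap-¬ₘ 𝟎 = refl
swap-¬ₘ 𝐧 = refl
swap-¬ₘ 𝐛 = refl
swap-¬ₘ 𝟏 = refl

swap-≻ₘ : ∀ x y → swap (x ≻ₘ y) ≡ swap x ≻ₘ swap y
swap-≻ₘ 𝟎 y = refl
swap-≻ₘ 𝟏 y = refl
swap-≻ₘ 𝐧 𝟎 = refl
swap-≻ₘ 𝐧 𝐧 = refl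
swap-≻ₘ 𝐧 𝐛 = refl
swap-≻ₘ 𝐧 𝟏 = refl
swap-≻ₘ 𝐛 𝟎 = refl
swap-≻ₘ 𝐛 𝐧 = refl
swap-≻ₘ 𝐛 𝐛 = refl
swap-≻ₘ 𝐛 𝟏 = refl

⟦⟧-swap : ∀ a v → ⟦ a ⟧ (swap ∘ v) ≡ swap (⟦ a ⟧ v)
⟦⟧-swap (var p) v = refl
⟦⟧-swap (~ a)   v = trans (cong ¬ₘ (⟦⟧-swap a v)) (sym (swap-¬ₘ (⟦ a ⟧ v)))
⟦⟧-swap (a ≻ b) v = trans (cong₂ _≻ₘ_ (⟦⟧-swap a v) (⟦⟧-swap b v)) (sym (swap-≻ₘ (⟦ a ⟧ v) (⟦ b ⟧ v)))

designated-both-ways⇒𝟏 : ∀ x → IsTrue (designated x) → IsTrue (designated (swap x)) → x ≡ 𝟏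
designated-both-ways⇒𝟏 𝟏 _ _ = refl

corollary5p5 : (α : Fm) → ⊢𝕋 α → ⊨TML α
corollary5p5 α ⊢α v =
  designated-both-ways⇒𝟏 (⟦ α ⟧ v) (provable⇒designated ⊢α v)
    (subst (IsTrue ∘ designated) (⟦⟧-swap α v) (provable⇒designated ⊢α (swap ∘ v)))
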